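{- Let $T$ be an unlabelled binary tree with $|T|$ nodes whose right interval partition has $\ell$ parts, and let $n \in \mathbb{N}$. The number of right strict binary search trees of shape $T$ whose labels all lie in $\{1,\ldots,n\}$ is $\binom{n+|T|-\ell}{n-\ell}$ if $\ell \le n$, and $0$ if $\ell > n$.
   Context: A right strict binary search tree is a rooted binary tree with nodes labelled by positive integers such that each node's label is $\ge$ every label in its left subtree and $<$ every label in its right subtree; its shape is its underlying unlabelled rooted binary tree (left/right children distinguished). The infix traversal of a binary tree recursively traverses the left subtree, visits the root, then traverses the right subtree. If $x_1,\ldots,x_m$ are the nodes in infix order, the right interval partition is obtained by cutting the sequence $x_1,\ldots,x_m$ immediately after each node having a non-empty right subtree; its parts are the resulting consecutive blocks. -}

module Defs where

open import Data.Nat using (ℕ; zero; suc; _+_; _≤_; _<_)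
open import Data.Bool using (Bool; true; false)
open import Data.List using (List; []; _∷_; _++_; length)
open import Data.Product using (Σ; _×_)
open import Data.Unit using (⊤)

data Tree : Set where
  leaf : Tree
  node : Tree → Tree → Tree

size : Tree → ℕ
size leaf = 0
size (node l r) = suc (size l + size r)

data Labelled : Tree → Set where
  leaf : Labelled leaf
  node : {l r : Tree} → Labelled l → ℕ → Labelled r → Labelled (node l r)

AllLabels : {T : Tree} → (ℕ → Set) → Labelled T → Set
AllLabels P leaf = ⊤
AllLabels P (node l x r) = AllLabels P l × P x × AllLabels P r

IsRSBST : {T : Tree} → Labelled T → Set
IsRSBST leaf = ⊤
IsRSBST (node l x r) =
  AllLabels (λ y → y ≤ x) l × AllLabels (λ y → x < y) r × IsRSBST l × IsRSBST r

LabelsIn : (n : ℕ) {T : Tree} → Labelled T → Set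
LabelsIn n = AllLabels (λ y → 1 ≤ y × y ≤ n)

RSBST : Tree → ℕ → Set
RSBST T n = Σ (Labelled T) (λ t → IsRSBST t × LabelsIn n t)

nonEmpty : Tree → Bool
nonEmpty leaf = false
nonEmpty (node _ _) = true

infixMarks : Tree → List Bool
infixMarks leaf = []
infixMarks (node l r) = infixMarks l ++ (nonEmpty r ∷ infixMarks r)

cutAfter : {A : Set} → (A → Bool) → List A → List (List A)
cutAfter p [] = []
cutAfter p (x ∷ xs) with p x | cutAfter p xs
... | true  | bs = (x ∷ []) ∷ bs
... | false | [] = (x ∷ []) ∷ []
... | false | (b ∷ bs) = (x ∷ b) ∷ bs

rightIntervalPartition : Tree → List (List Bool)
rightIntervalPartition T = cutAfter (λ b → b) (infixMarks T)

parts : Tree → ℕ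
parts T = length (rightIntervalPartition T)

-- The infix reading x₁, …, xₘ of a right strict binary search tree is weakly increasing, and
-- strictly increasing right after each node with a non-empty right subtree.  Removing the
-- infix-first node therefore gives a recursion for the number of such trees with labels in an
-- interval of k values: either its label is not the least value (k - 1 values remain), or it
-- is, and the rest of the tree draws from k or k - 1 values according to that node's mark.
-- This recursion depends on the shape only through its m marks, and Pascal's rule solves it
-- as C(k + m - ℓ, k - ℓ) when the marks are cut into ℓ ≤ k blocks, and as 0 when ℓ > k.
module Submission where

open import Defs
open import Data.Nat using (ℕ; _+_; _∸_; _≤_; _>_)
open import Data.Nat.Combinatorics using (_C_)
open import Data.Fin using (Fin)
open import Data.Product using (_×_)
open import Function.Bundles using (_↔_)

open import Data.Bool using (Bool; true; false)
open import Data.Empty using (⊥; ⊥-elim)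
open import Data.Fin.Properties using (+↔⊎; 0↔⊥)
open import Data.List using (List; []; _∷_; _++_; length)
open import Data.List.Properties using (length-++; ∷-injective)
open import Data.Nat using (zero; suc; _<_; z≤n; s≤s; _≟_)
open import Data.Nat.Combinatorics using (nCn≡1; nCk+nC[k+1]≡[n+1]C[k+1])
open import Data.Nat.Properties
open import Data.Product using (Σ; _,_; proj₁; proj₂)
open import Data.Sum using (_⊎_; inj₁; inj₂)
open import Data.Sum.Function.Propositional using (_⊎-↔_)
open import Data.Unit using (tt)
open import Function using (_∘_)
open import Function.Bundles using (mk↔ₛ′)
open import Function.Properties.Inverse using (↔-trans; ↔-sym)
open import Relation.Binary.PropositionalEquality
open import Relation.Nullary using (Dec; yes; no)
open import Relation.Unary using (Irrelevant)

dropLeftmost : Tree → Tree → Tree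
dropLeftmost leaf r = r
dropLeftmost (node ll lr) r = node (dropLeftmost ll lr) r

firstMark : Tree → Tree → Bool
firstMark leaf r = nonEmpty r
firstMark (node ll lr) r = firstMark ll lr

infixMarks-node : ∀ l r → infixMarks (node l r) ≡ firstMark l r ∷ infixMarks (dropLeftmost l r)
infixMarks-node leaf r = refl
infixMarks-node (node ll lr) r = cong (_++ (nonEmpty r ∷ infixMarks r)) (infixMarks-node ll lr)

leftmost : ∀ {l r} → Labelled (node l r) → ℕ
leftmost {leaf} (node leaf x _) = x
leftmost {node _ _} (node tl _ _) = leftmost tl

removeLeftmost : ∀ {l r} → Labelled (node l r) → Labelled (dropLeftmost l r)
removeLeftmost {leaf} (node leaf _ tr) = tr
removeLeftmost {node _ _} (node tl x tr) = node (removeLeftmost tl) x tr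

insertLeftmost : ∀ {l r} → ℕ → Labelled (dropLeftmost l r) → Labelled (node l r)
insertLeftmost {leaf} v t = node leaf v t
insertLeftmost {node _ _} v (node t x tr) = node (insertLeftmost v t) x tr

removeLeftmost-insertLeftmost : ∀ {l r} v (t : Labelled (dropLeftmost l r)) →
                                removeLeftmost {l} {r} (insertLeftmost v t) ≡ t
removeLeftmost-insertLeftmost {leaf} v t = refl
removeLeftmost-insertLeftmost {node ll lr} v (node t x tr) =
  cong (λ t′ → node t′ x tr) (removeLeftmost-insertLeftmost {ll} {lr} v t)

leftmost-insertLeftmost : ∀ {l r} v (t : Labelled (dropLeftmost l r)) →
                          leftmost {l} {r} (insertLeftmost v t) ≡ v
leftmost-insertLeftmost {leaf} v t = refl
leftmost-insertLeftmost {node ll lr} v (node t x tr) = leftmost-insertLeftmost {ll} {lr} v t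

insertLeftmost-removeLeftmost : ∀ {l r} (t : Labelled (node l r)) →
                                insertLeftmost (leftmost t) (removeLeftmost t) ≡ t
insertLeftmost-removeLeftmost {leaf} (node leaf x tr) = refl
insertLeftmost-removeLeftmost {node _ _} (node tl x tr) =
  cong (λ t′ → node t′ x tr) (insertLeftmost-removeLeftmost tl)

AllLabels-map : ∀ {T} {P Q : ℕ → Set} → (∀ {y} → P y → Q y) →
                (t : Labelled T) → AllLabels P t → AllLabels Q t
AllLabels-map f leaf _ = tt
AllLabels-map f (node l x r) (pl , px , pr) = AllLabels-map f l pl , f px , AllLabels-map f r pr

AllLabels-zipWith : ∀ {T} {P Q R : ℕ → Set} → (∀ {y} → P y → Q y → R y) →
                    (t : Labelled T) → AllLabels P t → AllLabels Q t → AllLabels R t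
AllLabels-zipWith f leaf _ _ = tt
AllLabels-zipWith f (node l x r) (pl , px , pr) (ql , qx , qr) =
  AllLabels-zipWith f l pl ql , f px qx , AllLabels-zipWith f r pr qr

AllLabels-irrelevant : ∀ {T} {P : ℕ → Set} → Irrelevant P → Irrelevant (AllLabels {T} P)
AllLabels-irrelevant irr {leaf} tt tt = refl
AllLabels-irrelevant irr {node l x r} (a , b , c) (a′ , b′ , c′) =
  cong₂ _,_ (AllLabels-irrelevant irr a a′)
            (cong₂ _,_ (irr b b′) (AllLabels-irrelevant irr c c′))

AllLabels-leftmost : ∀ {l r} {P : ℕ → Set} (t : Labelled (node l r)) →
                     AllLabels P t → P (leftmost t)
AllLabels-leftmost {leaf} (node leaf x tr) (_ , px , _) = px
AllLabels-leftmost {node _ _} (node tl x tr) (pl , _ , _) = AllLabels-leftmost tl pl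

AllLabels-removeLeftmost : ∀ {l r} {P : ℕ → Set} (t : Labelled (node l r)) →
                           AllLabels P t → AllLabels P (removeLeftmost t)
AllLabels-removeLeftmost {leaf} (node leaf x tr) (_ , _ , pr) = pr
AllLabels-removeLeftmost {node _ _} (node tl x tr) (pl , px , pr) =
  AllLabels-removeLeftmost tl pl , px , pr

AllLabels-insertLeftmost : ∀ {l r} {P : ℕ → Set} v (t : Labelled (dropLeftmost l r)) →
                           P v → AllLabels P t → AllLabels P (insertLeftmost {l} {r} v t)
AllLabels-insertLeftmost {leaf} v t pv pt = tt , pv , pt
AllLabels-insertLeftmost {node _ _} v (node t x tr) pv (pl , px , pr) =
  AllLabels-insertLeftmost v t pv pl , px , pr

IsRSBST-irrelevant : ∀ {T} → Irrelevant (IsRSBST {T})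
IsRSBST-irrelevant {x = leaf} tt tt = refl
IsRSBST-irrelevant {x = node l x r} (a , b , c , d) (a′ , b′ , c′ , d′) =
  cong₂ _,_ (AllLabels-irrelevant ≤-irrelevant a a′)
    (cong₂ _,_ (AllLabels-irrelevant <-irrelevant b b′)
      (cong₂ _,_ (IsRSBST-irrelevant c c′) (IsRSBST-irrelevant d d′)))

IsRSBST-removeLeftmost : ∀ {l r} (t : Labelled (node l r)) →
                         IsRSBST t → IsRSBST (removeLeftmost t)
IsRSBST-removeLeftmost {leaf} (node leaf x tr) (_ , _ , _ , bst-r) = bst-r
IsRSBST-removeLeftmost {node _ _} (node tl x tr) (≤x , x< , bst-l , bst-r) =
  AllLabels-removeLeftmost tl ≤x , x< , IsRSBST-removeLeftmost tl bst-l , bst-r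

IsRSBST-insertLeftmost : ∀ {l r} v (t : Labelled (dropLeftmost l r)) →
                         IsRSBST t → AllLabels (v ≤_) t →
                         (firstMark l r ≡ true → AllLabels (v <_) t) →
                         IsRSBST (insertLeftmost {l} {r} v t)
IsRSBST-insertLeftmost {leaf} {leaf} v leaf _ _ _ = tt , tt , tt , tt
IsRSBST-insertLeftmost {leaf} {node _ _} v t bst _ v< = tt , v< refl , tt , bst
IsRSBST-insertLeftmost {node _ _} v (node t x tr) (≤x , x< , bst-l , bst-r) (v≤l , v≤x , _) v< =
  AllLabels-insertLeftmost v t v≤x ≤x , x< ,
  IsRSBST-insertLeftmost v t bst-l v≤l (λ e → proj₁ (v< e)) , bst-r

leftmost-≤ : ∀ {l r} (t : Labelled (node l r)) → IsRSBST t → AllLabels (leftmost t ≤_) t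
leftmost-≤ {leaf} (node leaf x tr) (_ , x< , _ , _) = tt , ≤-refl , AllLabels-map <⇒≤ tr x<
leftmost-≤ {node _ _} (node tl x tr) (≤x , x< , bst-l , _) =
  leftmost-≤ tl bst-l , m≤x , AllLabels-map (λ x<y → ≤-trans m≤x (<⇒≤ x<y)) tr x<
  where m≤x = AllLabels-leftmost tl ≤x

-- A true first mark means the infix-first node has a right child, whose label lies strictly
-- between the two.
leftmost-<-upperBound : ∀ {l r} x (t : Labelled (node l r)) → IsRSBST t →
                        firstMark l r ≡ true → AllLabels (_≤ x) t → leftmost t < x
leftmost-<-upperBound {leaf} {node _ _} x (node leaf v (node _ y _))
                      (_ , (_ , v<y , _) , _) _ (_ , _ , (_ , y≤x , _)) = <-≤-trans v<y y≤x
leftmost-<-upperBound {node _ _} x (node tl _ _) (_ , _ , bst-l , _) e (≤x , _ , _) =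
  leftmost-<-upperBound x tl bst-l e ≤x

leftmost-< : ∀ {l r} (t : Labelled (node l r)) → IsRSBST t → firstMark l r ≡ true →
             AllLabels (leftmost t <_) (removeLeftmost t)
leftmost-< {leaf} (node leaf x tr) (_ , x< , _ , _) _ = x<
leftmost-< {node _ _} (node tl x tr) (≤x , x< , bst-l , _) e =
  leftmost-< tl bst-l e , m<x , AllLabels-map (<-trans m<x) tr x<
  where m<x = leftmost-<-upperBound x tl bst-l e ≤x

Bounded : ℕ → ℕ → ℕ → Set
Bounded lo hi y = lo ≤ y × y ≤ hi

Bounded-irrelevant : ∀ {lo hi} → Irrelevant (Bounded lo hi)
Bounded-irrelevant (a , b) (a′ , b′) = cong₂ _,_ (≤-irrelevant a a′) (≤-irrelevant b b′)

RSBSTIn : Tree → ℕ → ℕ → Set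
RSBSTIn T lo hi = Σ (Labelled T) (λ t → IsRSBST t × AllLabels (Bounded lo hi) t)

RSBSTIn-≡ : ∀ {T lo hi} {t t′ : Labelled T} → t ≡ t′ →
            (p : IsRSBST t × AllLabels (Bounded lo hi) t)
            (p′ : IsRSBST t′ × AllLabels (Bounded lo hi) t′) →
            _≡_ {A = RSBSTIn T lo hi} (t , p) (t′ , p′)
RSBSTIn-≡ refl (a , b) (a′ , b′) =
  cong (_ ,_) (cong₂ _,_ (IsRSBST-irrelevant a a′) (AllLabels-irrelevant Bounded-irrelevant b b′))

RSBSTIn-leaf : ∀ lo hi → RSBSTIn leaf lo hi ↔ Fin 1
RSBSTIn-leaf lo hi = mk↔ₛ′ (λ _ → Fin.zero) (λ _ → leaf , tt , tt)
  (λ { Fin.zero → refl ; (Fin.suc ()) }) (λ { (leaf , tt , tt) → refl })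
  where import Data.Fin as Fin

RSBSTIn-empty : ∀ {l r lo hi} → hi < lo → RSBSTIn (node l r) lo hi ↔ Fin 0
RSBSTIn-empty hi<lo = ↔-sym (↔-trans 0↔⊥ (mk↔ₛ′ (λ ()) absurd (λ t → ⊥-elim (absurd t)) (λ ())))
  where
  absurd : RSBSTIn (node _ _) _ _ → ⊥
  absurd (node _ x _ , _ , (_ , (lo≤x , x≤hi) , _)) = <-irrefl refl (<-≤-trans hi<lo (≤-trans lo≤x x≤hi))

-- The least label still available once the infix-first node has taken the least value lo.
boundAfter : Bool → ℕ → ℕ
boundAfter true lo = suc lo
boundAfter false lo = lo

≤-boundAfter : ∀ b lo → lo ≤ boundAfter b lo
≤-boundAfter true lo = n≤1+n lo
≤-boundAfter false lo = ≤-refl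

removeLeftmost-bounded : ∀ {l r lo hi} (t : Labelled (node l r)) → IsRSBST t →
                         AllLabels (Bounded lo hi) t → leftmost t ≡ lo →
                         AllLabels (Bounded (boundAfter (firstMark l r) lo) hi) (removeLeftmost t)
removeLeftmost-bounded {l} {r} t bst bounded refl with firstMark l r in e
... | false = AllLabels-removeLeftmost t bounded
... | true  = AllLabels-zipWith (λ m<y (_ , y≤hi) → m<y , y≤hi)
                (removeLeftmost t) (leftmost-< t bst e) (AllLabels-removeLeftmost t bounded)

module _ (l r : Tree) (lo hi : ℕ) (lo≤hi : lo ≤ hi) where

  private
    Rest : Set
    Rest = RSBSTIn (dropLeftmost l r) (boundAfter (firstMark l r) lo) hi

    splitOn : (t : Labelled (node l r)) → IsRSBST t → AllLabels (Bounded lo hi) t →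
              Dec (leftmost t ≡ lo) → RSBSTIn (node l r) (suc lo) hi ⊎ Rest
    splitOn t bst bounded (yes m≡lo) =
      inj₂ (removeLeftmost t , IsRSBST-removeLeftmost t bst , removeLeftmost-bounded t bst bounded m≡lo)
    splitOn t bst bounded (no m≢lo) =
      inj₁ (t , bst , AllLabels-zipWith (λ m≤y (_ , y≤hi) → <-≤-trans lo<m m≤y , y≤hi)
                        t (leftmost-≤ t bst) bounded)
      where lo<m = ≤∧≢⇒< (proj₁ (AllLabels-leftmost t bounded)) (m≢lo ∘ sym)

    splitLeftmost : RSBSTIn (node l r) lo hi → RSBSTIn (node l r) (suc lo) hi ⊎ Rest
    splitLeftmost (t , bst , bounded) = splitOn t bst bounded (leftmost t ≟ lo)

    join : RSBSTIn (node l r) (suc lo) hi ⊎ Rest → RSBSTIn (node l r) lo hi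
    join (inj₁ (t , bst , bounded)) = t , bst , AllLabels-map (λ (lo<y , y≤hi) → <⇒≤ lo<y , y≤hi) t bounded
    join (inj₂ (t , bst , bounded)) =
      insertLeftmost lo t ,
      IsRSBST-insertLeftmost lo t bst (AllLabels-map (≤-trans (≤-boundAfter _ lo) ∘ proj₁) t bounded)
        (λ e → AllLabels-map (λ (b≤y , _) → subst (λ b → boundAfter b lo ≤ _) e b≤y) t bounded) ,
      AllLabels-insertLeftmost lo t (≤-refl , lo≤hi)
        (AllLabels-map (λ (b≤y , y≤hi) → ≤-trans (≤-boundAfter _ lo) b≤y , y≤hi) t bounded)

    split-join : ∀ x → splitLeftmost (join x) ≡ x
    split-join (inj₁ (t , _ , bounded)) with leftmost t ≟ lo
    ... | yes m≡lo = ⊥-elim (<-irrefl (sym m≡lo) (proj₁ (AllLabels-leftmost t bounded)))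
    ... | no _ = cong inj₁ (RSBSTIn-≡ refl _ _)
    split-join (inj₂ (t , _ , _)) with leftmost (insertLeftmost {l} {r} lo t) ≟ lo
    ... | yes _ = cong inj₂ (RSBSTIn-≡ (removeLeftmost-insertLeftmost {l} {r} lo t) _ _)
    ... | no m≢lo = ⊥-elim (m≢lo (leftmost-insertLeftmost {l} {r} lo t))

    join-split : ∀ x → join (splitLeftmost x) ≡ x
    join-split (t , _ , _) with leftmost t ≟ lo
    ... | yes refl = RSBSTIn-≡ (insertLeftmost-removeLeftmost t) _ _
    ... | no _ = RSBSTIn-≡ refl _ _

  RSBSTIn-split : RSBSTIn (node l r) lo hi ↔
                  (RSBSTIn (node l r) (suc lo) hi ⊎ RSBSTIn (dropLeftmost l r) (boundAfter (firstMark l r) lo) hi)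
  RSBSTIn-split = mk↔ₛ′ splitLeftmost join split-join join-split

-- The number of values left for the remaining nodes, out of k + 1, once the infix-first
-- node has taken the least one.
valuesAfter : Bool → ℕ → ℕ
valuesAfter true k = k
valuesAfter false k = suc k

valuesAfter+boundAfter : ∀ b k lo → valuesAfter b k + boundAfter b lo ≡ suc k + lo
valuesAfter+boundAfter true k lo = +-suc k lo
valuesAfter+boundAfter false k lo = refl

-- chains ms k counts the sequences of length |ms| in a set of k consecutive values that are
-- weakly increasing, and strictly increasing right after each position marked true.
chains : List Bool → ℕ → ℕ
chains [] k = 1
chains (b ∷ ms) zero = 0
chains (b ∷ ms) (suc k) = chains (b ∷ ms) k + chains ms (valuesAfter b k)

-- k = hi + 1 - lo is the number of available values, tied to lo and hi by an equation
-- rather than by truncated subtraction.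
RSBSTIn↔chains : ∀ ms T → infixMarks T ≡ ms → ∀ k lo hi → suc hi ≡ k + lo →
                 RSBSTIn T lo hi ↔ Fin (chains ms k)
RSBSTIn-node↔chains : ∀ ms l r → infixMarks (dropLeftmost l r) ≡ ms → ∀ k lo hi → suc hi ≡ k + lo →
                      RSBSTIn (node l r) lo hi ↔ Fin (chains (firstMark l r ∷ ms) k)

RSBSTIn↔chains [] leaf _ k lo hi _ = RSBSTIn-leaf lo hi
RSBSTIn↔chains [] (node l r) e with () ← trans (sym (infixMarks-node l r)) e
RSBSTIn↔chains (b ∷ ms) (node l r) e k lo hi ek =
  subst (λ c → RSBSTIn (node l r) lo hi ↔ Fin (chains (c ∷ ms) k)) b≡ (RSBSTIn-node↔chains ms l r ms≡ k lo hi ek)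
  where
  b≡ : firstMark l r ≡ b
  b≡ = proj₁ (∷-injective (trans (sym (infixMarks-node l r)) e))
  ms≡ : infixMarks (dropLeftmost l r) ≡ ms
  ms≡ = proj₂ (∷-injective (trans (sym (infixMarks-node l r)) e))

RSBSTIn-node↔chains ms l r e zero lo hi ek = RSBSTIn-empty (≤-reflexive ek)
RSBSTIn-node↔chains ms l r e (suc k) lo hi ek =
  ↔-trans (RSBSTIn-split l r lo hi lo≤hi)
          (↔-trans (RSBSTIn-node↔chains ms l r e k (suc lo) hi (trans ek (sym (+-suc k lo)))
                      ⊎-↔ RSBSTIn↔chains ms (dropLeftmost l r) e (valuesAfter b k) (boundAfter b lo) hi
                            (trans ek (sym (valuesAfter+boundAfter b k lo))))
                   (↔-sym +↔⊎))
  where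
  b = firstMark l r
  lo≤hi : lo ≤ hi
  lo≤hi = ≤-pred (subst (suc lo ≤_) (sym ek) (s≤s (m≤n+m lo k)))

blockCount : List Bool → ℕ
blockCount [] = 0
blockCount (true ∷ ms) = suc (blockCount ms)
blockCount (false ∷ []) = 1
blockCount (false ∷ m ∷ ms) = blockCount (m ∷ ms)

blockCount-∷-pos : ∀ b ms → 0 < blockCount (b ∷ ms)
blockCount-∷-pos true ms = s≤s z≤n
blockCount-∷-pos false [] = s≤s z≤n
blockCount-∷-pos false (m ∷ ms) = blockCount-∷-pos m ms

blockCount≡length-cutAfter : ∀ ms → blockCount ms ≡ length (cutAfter (λ b → b) ms)
blockCount≡length-cutAfter [] = refl
blockCount≡length-cutAfter (true ∷ ms) = cong suc (blockCount≡length-cutAfter ms)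
blockCount≡length-cutAfter (false ∷ []) = refl
blockCount≡length-cutAfter (false ∷ m ∷ ms)
  with cutAfter (λ b → b) (m ∷ ms) | blockCount≡length-cutAfter (m ∷ ms)
... | [] | e = ⊥-elim (<-irrefl (sym e) (blockCount-∷-pos m ms))
... | _ ∷ _ | e = e

valuesAfter-< : ∀ b ms k → suc k < blockCount (b ∷ ms) → valuesAfter b k < blockCount ms
valuesAfter-< true ms k (s≤s k<) = k<
valuesAfter-< false [] k (s≤s ())
valuesAfter-< false (m ∷ ms) k k< = k<

chains-below : ∀ ms k → k < blockCount ms → chains ms k ≡ 0
chains-below (b ∷ ms) zero _ = refl
chains-below (b ∷ ms) (suc k) k< =
  cong₂ _+_ (chains-below (b ∷ ms) k (<-trans (n<1+n k) k<)) (chains-below ms _ (valuesAfter-< b ms k k<))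

pascal : ∀ j m → (j + suc m) C j + (suc j + m) C suc j ≡ (suc j + suc m) C suc j
pascal j m rewrite +-suc j m = nCk+nC[k+1]≡[n+1]C[k+1] (suc (j + m)) j

[j+0]Cj≡1 : ∀ j → (j + 0) C j ≡ 1
[j+0]Cj≡1 j rewrite +-identityʳ j = nCn≡1 j

chains-from : ∀ ms k j → k ≡ blockCount ms + j → chains ms k ≡ (j + length ms) C j
chains-valuesAfter : ∀ b ms k j → suc k ≡ blockCount (b ∷ ms) + j → chains ms (valuesAfter b k) ≡ (j + length ms) C j

chains-from [] k j _ = sym ([j+0]Cj≡1 j)
chains-from (b ∷ ms) zero j e = ⊥-elim (<-irrefl e (<-≤-trans (blockCount-∷-pos b ms) (m≤m+n _ j)))
chains-from (b ∷ ms) (suc k) zero e =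
  cong₂ _+_ (chains-below (b ∷ ms) k (≤-reflexive (trans e (+-identityʳ _))))
            (chains-valuesAfter b ms k zero e)
chains-from (b ∷ ms) (suc k) (suc j) e = begin
  chains (b ∷ ms) k + chains ms (valuesAfter b k)
    ≡⟨ cong₂ _+_ (chains-from (b ∷ ms) k j (suc-injective (trans e (+-suc _ j)))) (chains-valuesAfter b ms k (suc j) e) ⟩
  (j + suc (length ms)) C j + (suc j + length ms) C suc j
    ≡⟨ pascal j (length ms) ⟩
  (suc j + suc (length ms)) C suc j ∎
  where open ≡-Reasoning

chains-valuesAfter b [] k j _ = sym ([j+0]Cj≡1 j)
chains-valuesAfter true (m ∷ ms) k j e = chains-from (m ∷ ms) k j (suc-injective e)
chains-valuesAfter false (m ∷ ms) k j e = chains-from (m ∷ ms) (suc k) j e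

chains≡binomial : ∀ ms k → blockCount ms ≤ k →
                  chains ms k ≡ (k + length ms ∸ blockCount ms) C (k ∸ blockCount ms)
chains≡binomial ms k p≤k with m≤n⇒∃[o]m+o≡n p≤k
... | j , refl = begin
  chains ms (p + j)                ≡⟨ chains-from ms (p + j) j refl ⟩
  (j + length ms) C j              ≡⟨ cong₂ _C_ (sym (m+n∸m≡n p (j + length ms))) (sym (m+n∸m≡n p j)) ⟩
  (p + (j + length ms) ∸ p) C (p + j ∸ p)
                                   ≡⟨ cong (λ x → (x ∸ p) C (p + j ∸ p)) (+-assoc p j (length ms)) ⟨
  (p + j + length ms ∸ p) C (p + j ∸ p) ∎
  where
  open ≡-Reasoning
  p = blockCount ms

length-infixMarks : ∀ T → length (infixMarks T) ≡ size T
length-infixMarks leaf = refl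
length-infixMarks (node l r) = begin
  length (infixMarks l ++ nonEmpty r ∷ infixMarks r)  ≡⟨ length-++ (infixMarks l) ⟩
  length (infixMarks l) + suc (length (infixMarks r)) ≡⟨ cong₂ (λ a b → a + suc b) (length-infixMarks l) (length-infixMarks r) ⟩
  size l + suc (size r)                               ≡⟨ +-suc (size l) (size r) ⟩
  size (node l r) ∎
  where open ≡-Reasoning

RSBST↔chains : ∀ T n → RSBST T n ↔ Fin (chains (infixMarks T) n)
RSBST↔chains T n = RSBSTIn↔chains (infixMarks T) T refl n 1 n (+-comm 1 n)

proposition13 : (T : Tree) (n : ℕ) →
    (parts T ≤ n → RSBST T n ↔ Fin ((n + size T ∸ parts T) C (n ∸ parts T)))
    × (parts T > n → RSBST T n ↔ Fin 0)
proposition13 T n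
  rewrite sym (blockCount≡length-cutAfter (infixMarks T)) | sym (length-infixMarks T) =
    (λ p≤n → subst (λ c → RSBST T n ↔ Fin c) (chains≡binomial (infixMarks T) n p≤n) (RSBST↔chains T n)) ,
    (λ p>n → subst (λ c → RSBST T n ↔ Fin c) (chains-below (infixMarks T) n p>n) (RSBST↔chains T n))
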